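{- Let $\Gamma$ be a vertex-transitive graph admitting a strong clique. Then $\Gamma$ is localizable if and only if $\chi(\overline{\Gamma})=\omega(\overline{\Gamma})$.
   Context: All graphs are finite and simple. A clique is strong if it intersects every inclusion-maximal independent set. A graph is localizable if its vertex set can be partitioned into strong cliques. $\overline{\Gamma}$ is the complement of $\Gamma$, $\chi$ denotes chromatic number and $\omega$ clique number (size of a largest clique). A graph is vertex-transitive if its automorphism group acts transitively on its vertices. -}

module Defs where

open import Data.Nat using (ℕ; _≤_)
open import Data.Bool using (Bool; true; false; not; if_then_else_)
open import Data.Fin using (Fin; _≟_)
open import Data.Fin.Subset using (Subset; _∈_; _⊆_; ∣_∣)
open import Data.Fin.Permutation using (Permutation′; _⟨$⟩ʳ_)
open import Data.Product using (Σ; ∃; ∃-syntax; _×_; ∃!)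
open import Relation.Nullary using (¬_; does)
open import Relation.Binary.PropositionalEquality using (_≡_; _≢_)

record Graph (n : ℕ) : Set where
  field
    adj    : Fin n → Fin n → Bool
    sym    : ∀ u v → adj u v ≡ adj v u
    irrefl : ∀ v → adj v v ≡ false
open Graph public

complement : ∀ {n} → Graph n → Graph n
complement {n} G = record { adj = a ; sym = s ; irrefl = i }
  where
  a : Fin n → Fin n → Bool
  a u v = if does (u ≟ v) then false else not (adj G u v)
  s : ∀ u v → a u v ≡ a v u
  s u v with u ≟ v | v ≟ u
  ... | Relation.Nullary.yes _ | Relation.Nullary.yes _ = Relation.Binary.PropositionalEquality.refl
  ... | Relation.Nullary.yes p | Relation.Nullary.no q = Data.Empty.⊥-elim (q (Relation.Binary.PropositionalEquality.sym p))
    where import Data.Empty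
  ... | Relation.Nullary.no p | Relation.Nullary.yes q = Data.Empty.⊥-elim (p (Relation.Binary.PropositionalEquality.sym q))
    where import Data.Empty
  ... | Relation.Nullary.no _ | Relation.Nullary.no _ = Relation.Binary.PropositionalEquality.cong not (sym G u v)
  i : ∀ v → a v v ≡ false
  i v with v ≟ v
  ... | Relation.Nullary.yes _ = Relation.Binary.PropositionalEquality.refl
  ... | Relation.Nullary.no p = Data.Empty.⊥-elim (p Relation.Binary.PropositionalEquality.refl)
    where import Data.Empty

module _ {n : ℕ} (G : Graph n) where

  IsClique : Subset n → Set
  IsClique S = ∀ u v → u ∈ S → v ∈ S → u ≢ v → adj G u v ≡ true

  IsIndependent : Subset n → Set
  IsIndependent S = ∀ u v → u ∈ S → v ∈ S → u ≢ v → adj G u v ≡ false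

  IsMaximalIndependent : Subset n → Set
  IsMaximalIndependent I =
    IsIndependent I × (∀ T → IsIndependent T → I ⊆ T → T ⊆ I)

  IsStrongClique : Subset n → Set
  IsStrongClique C =
    IsClique C × (∀ I → IsMaximalIndependent I → ∃[ v ] (v ∈ C × v ∈ I))

  HasStrongClique : Set
  HasStrongClique = ∃[ C ] IsStrongClique C

  Localizable : Set
  Localizable =
    ∃[ k ] Σ (Fin k → Subset n) λ P →
      (∀ j → IsStrongClique (P j)) × (∀ v → ∃! _≡_ (λ j → v ∈ P j))

  IsAutomorphism : Permutation′ n → Set
  IsAutomorphism σ = ∀ u v → adj G (σ ⟨$⟩ʳ u) (σ ⟨$⟩ʳ v) ≡ adj G u v

  VertexTransitive : Set
  VertexTransitive =
    ∀ u v → Σ (Permutation′ n) λ σ → IsAutomorphism σ × σ ⟨$⟩ʳ u ≡ v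

  Colourable : ℕ → Set
  Colourable k =
    Σ (Fin n → Fin k) λ c → ∀ u v → adj G u v ≡ true → c u ≢ c v

  IsChromaticNumber : ℕ → Set
  IsChromaticNumber k = Colourable k × (∀ k′ → Colourable k′ → k ≤ k′)

  IsCliqueNumber : ℕ → Set
  IsCliqueNumber w =
    (∃[ S ] (IsClique S × ∣ S ∣ ≡ w)) × (∀ S → IsClique S → ∣ S ∣ ≤ w)

  ChiEqualsOmega : Set
  ChiEqualsOmega = ∃[ k ] (IsChromaticNumber k × IsCliqueNumber k)

-- If Γ is partitioned into strong cliques, the classes properly colour the complement, and a
-- maximal independent set of Γ meets every class exactly once; it is therefore a clique of the
-- complement with as many vertices as there are classes, so χ = ω there.  Conversely, the colour
-- classes of an optimal colouring of the complement are cliques of Γ, and such a class is strong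
-- as soon as every maximal independent set has exactly ω vertices.  That is where vertex-
-- transitivity enters: for a strong clique C and a maximal independent set I, every automorphism f
-- pulls I back to a maximal independent set, which C meets exactly once, so double counting the
-- pairs (f, c) with c ∈ C and f c ∈ I gives |Aut Γ| = |C| · |I| · N, where N, the number of
-- automorphisms sending a vertex c to a vertex w, does not depend on c and w.  Automorphisms are
-- counted through the codes in Fin (n ^ n) of all maps Fin n → Fin n.

module Submission where

open import Defs renaming (sym to adj-sym; irrefl to adj-irrefl)
open import Level using (0ℓ)
open import Data.Nat using (ℕ; zero; suc; _+_; _*_; _^_; _≤_; z≤n; s≤s; >-nonZero)
open import Data.Nat.Properties
  using ( +-*-semiring; ≤-trans; ≤-reflexive; ≤-antisym; <-irrefl; +-mono-≤; m≤n+m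
        ; +-identityʳ; *-identityʳ; *-zeroʳ; *-cancelˡ-≡; *-cancelʳ-≡)
import Data.Nat.Properties as ℕ
open import Data.Nat.Tactic.RingSolver using (solve-∀)
open import Data.Bool using (true; false; if_then_else_)
import Data.Bool.Properties as Bool
open import Data.Fin using (Fin; zero; suc; _≟_; finToFun; funToFin; combine)
open import Data.Fin.Properties using (0≢1+n; suc-injective; any?; all?; funToFin-finToFin; finToFun-funToFin)
open import Data.Fin.Subset using (Subset; _∈_; _∉_; _⊆_; _⊃_; _∪_; ⁅_⁆; ⊥; ∣_∣; inside; outside)
open import Data.Fin.Subset.Properties
  using (_∈?_; x∈p∪q⁻; x∈⁅y⁆⇒x≡y; x∈⁅x⁆; p⊆p∪q; q⊆p∪q; ∉⊥; p⊆q⇒∣p∣≤∣q∣)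
open import Data.Fin.Subset.Induction using (Acc; acc; ⊃-wellFounded)
open import Data.Fin.Permutation using (Permutation′; _⟨$⟩ʳ_; _⟨$⟩ˡ_; permutation; inverseˡ; inverseʳ; flip)
open import Data.Vec using ([]; _∷_; tabulate)
open import Data.Vec.Properties using (lookup∘tabulate; []=⇒lookup; lookup⇒[]=)
open import Data.Sum using (inj₁; inj₂)
open import Data.Product using (∃; ∃-syntax; _×_; _,_; proj₁; proj₂)
open import Function using (_∘_; id; _⇔_; mk⇔; Equivalence)
open import Relation.Unary using (Pred; Decidable)
open import Relation.Nullary using (Dec; yes; no; does; ¬_; contradiction)
open import Relation.Nullary.Decidable using (_×-dec_; _→-dec_; ¬?; map′; dec-true; does-⇔)
open import Relation.Binary.PropositionalEquality
  using (_≡_; _≢_; refl; sym; trans; cong; cong₂; subst; module ≡-Reasoning)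
open import Algebra.Properties.Semiring.Sum +-*-semiring
  using (sum; sum-syntax; ∑-comm; sum-cong-≗; sum-permute; sum-replicate-zero; *-distribˡ-sum; *-distribʳ-sum)

⟦_⟧ : ∀ {A : Set} → Dec A → ℕ
⟦ a? ⟧ = if does a? then 1 else 0

⟦×-dec⟧ : ∀ {A B : Set} (a? : Dec A) (b? : Dec B) → ⟦ a? ×-dec b? ⟧ ≡ ⟦ a? ⟧ * ⟦ b? ⟧
⟦×-dec⟧ (yes _) b? = sym (+-identityʳ ⟦ b? ⟧)
⟦×-dec⟧ (no _)  b? = refl

⟦⟧*≡⟦⟧ : ∀ {A : Set} {k} (a? : Dec A) → (A → k ≡ 1) → ⟦ a? ⟧ * k ≡ ⟦ a? ⟧
⟦⟧*≡⟦⟧ (yes a) k≡1 = trans (+-identityʳ _) (k≡1 a)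
⟦⟧*≡⟦⟧ (no _)  _   = refl

sum≤size : ∀ {m} (f : Fin m → ℕ) → (∀ j → f j ≤ 1) → sum f ≤ m
sum≤size {zero}  f f≤1 = z≤n
sum≤size {suc m} f f≤1 = +-mono-≤ (f≤1 zero) (sum≤size (f ∘ suc) (f≤1 ∘ suc))

sum≡size⇒1≤ : ∀ {m} (f : Fin m → ℕ) → (∀ j → f j ≤ 1) → sum f ≡ m → ∀ j → 1 ≤ f j
sum≡size⇒1≤ {suc m} f f≤1 eq j with f zero in f₀ | f≤1 zero | eq
... | 0 | _ | eq′ = contradiction (≤-trans (≤-reflexive (sym eq′)) (sum≤size (f ∘ suc) (f≤1 ∘ suc))) (<-irrefl refl)
... | 1 | _ | eq′ with j
...   | zero  = ≤-reflexive (sym f₀)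
...   | suc j = sum≡size⇒1≤ (f ∘ suc) (f≤1 ∘ suc) (ℕ.suc-injective eq′) j
sum≡size⇒1≤ {suc m} f f≤1 eq j | suc (suc _) | s≤s () | _

count : ∀ {n} {P : Pred (Fin n) 0ℓ} → Decidable P → ℕ
count {n} P? = ∑[ x < n ] ⟦ P? x ⟧

AtMostOne : ∀ {A : Set} → Pred A 0ℓ → Set
AtMostOne P = ∀ {x y} → P x → P y → x ≡ y

count-∅ : ∀ {n} {P : Pred (Fin n) 0ℓ} (P? : Decidable P) → (∀ x → ¬ P x) → count P? ≡ 0
count-∅ {zero}  P? none = refl
count-∅ {suc n} P? none with P? zero
... | yes p = contradiction p (none zero)
... | no _  = count-∅ (P? ∘ suc) (none ∘ suc)

count≤1 : ∀ {n} {P : Pred (Fin n) 0ℓ} (P? : Decidable P) → AtMostOne P → count P? ≤ 1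
count≤1 {zero}  P? unique = z≤n
count≤1 {suc n} P? unique with P? zero
... | yes p = ≤-reflexive (cong suc (count-∅ (P? ∘ suc) (λ x q → 0≢1+n (unique p q))))
... | no _  = count≤1 (P? ∘ suc) (λ p q → suc-injective (unique p q))

1≤count : ∀ {n} {P : Pred (Fin n) 0ℓ} (P? : Decidable P) {x} → P x → 1 ≤ count P?
1≤count P? {zero} p with P? zero
... | yes _ = s≤s z≤n
... | no ¬p = contradiction p ¬p
1≤count P? {suc x} p = ≤-trans (1≤count (P? ∘ suc) p) (m≤n+m _ ⟦ P? zero ⟧)

1≤count⇒∃ : ∀ {n} {P : Pred (Fin n) 0ℓ} (P? : Decidable P) → 1 ≤ count P? → ∃ P
1≤count⇒∃ {suc n} P? pos with P? zero
... | yes p = zero , p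
... | no _  with 1≤count⇒∃ (P? ∘ suc) pos
...   | x , p = suc x , p

count≡1 : ∀ {n} {P : Pred (Fin n) 0ℓ} (P? : Decidable P) {x} → P x → AtMostOne P → count P? ≡ 1
count≡1 P? p unique = ≤-antisym (count≤1 P? unique) (1≤count P? p)

count-fibres : ∀ {n m} {P : Pred (Fin n) 0ℓ} (P? : Decidable P) (c : Fin n → Fin m) →
  count P? ≡ ∑[ j < m ] count (λ x → P? x ×-dec c x ≟ j)
count-fibres {n} {m} P? c = begin
  ∑[ x < n ] ⟦ P? x ⟧                          ≡⟨ sum-cong-≗ indicator-as-count ⟩
  ∑[ x < n ] ∑[ j < m ] ⟦ P? x ×-dec c x ≟ j ⟧ ≡⟨ ∑-comm (λ x j → ⟦ P? x ×-dec c x ≟ j ⟧) ⟩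
  ∑[ j < m ] ∑[ x < n ] ⟦ P? x ×-dec c x ≟ j ⟧ ∎
  where
  open ≡-Reasoning
  indicator-as-count : ∀ x → ⟦ P? x ⟧ ≡ count (λ j → P? x ×-dec c x ≟ j)
  indicator-as-count x with P? x
  ... | yes p = sym (count≡1 (λ j → yes p ×-dec c x ≟ j) (p , refl) λ (_ , e) (_ , e′) → trans (sym e) e′)
  ... | no ¬p = sym (count-∅ (λ j → no ¬p ×-dec c x ≟ j) λ _ (p , _) → ¬p p)

count-permute : ∀ {n} {P Q : Pred (Fin n) 0ℓ} (P? : Decidable P) (Q? : Decidable Q) (π : Permutation′ n) →
  (∀ i → P (π ⟨$⟩ʳ i) ⇔ Q i) → count P? ≡ count Q?
count-permute P? Q? π P∘π⇔Q = trans (sum-permute (λ i → ⟦ P? i ⟧) π)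
  (sum-cong-≗ λ i → cong (λ b → if b then 1 else 0) (does-⇔ (P∘π⇔Q i) (P? (π ⟨$⟩ʳ i)) (Q? i)))

∣∣≡count : ∀ {n} (S : Subset n) → ∣ S ∣ ≡ count (_∈? S)
∣∣≡count []            = refl
∣∣≡count (inside ∷ S)  = cong suc (∣∣≡count S)
∣∣≡count (outside ∷ S) = ∣∣≡count S

module _ {n m : ℕ} (S : Subset n) (c : Fin n → Fin m) where

  InjectiveOn : Set
  InjectiveOn = ∀ {x y} → x ∈ S → y ∈ S → c x ≡ c y → x ≡ y

  SurjectiveOn : Set
  SurjectiveOn = ∀ j → ∃[ x ] (x ∈ S × c x ≡ j)

  private
    fibre? : ∀ j → Decidable (λ x → x ∈ S × c x ≡ j)
    fibre? j x = x ∈? S ×-dec c x ≟ j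

    fibreSize : Fin m → ℕ
    fibreSize j = count (fibre? j)

    ∣∣≡∑fibreSize : ∣ S ∣ ≡ sum fibreSize
    ∣∣≡∑fibreSize = trans (∣∣≡count S) (count-fibres (_∈? S) c)

    fibreSize≤1 : InjectiveOn → ∀ j → fibreSize j ≤ 1
    fibreSize≤1 inj j = count≤1 (fibre? j) λ (x∈S , cx≡j) (y∈S , cy≡j) → inj x∈S y∈S (trans cx≡j (sym cy≡j))

  injectiveOn⇒∣∣≤ : InjectiveOn → ∣ S ∣ ≤ m
  injectiveOn⇒∣∣≤ inj = ≤-trans (≤-reflexive ∣∣≡∑fibreSize) (sum≤size fibreSize (fibreSize≤1 inj))

  injectiveOn∧∣∣≡⇒surjectiveOn : InjectiveOn → ∣ S ∣ ≡ m → SurjectiveOn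
  injectiveOn∧∣∣≡⇒surjectiveOn inj ∣S∣≡m j =
    1≤count⇒∃ (fibre? j) (sum≡size⇒1≤ fibreSize (fibreSize≤1 inj) (trans (sym ∣∣≡∑fibreSize) ∣S∣≡m) j)

  bijectiveOn⇒∣∣≡ : InjectiveOn → SurjectiveOn → ∣ S ∣ ≡ m
  bijectiveOn⇒∣∣≡ inj surj = trans ∣∣≡∑fibreSize (trans (sum-cong-≗ fibreSize≡1) (count-all m))
    where
    fibreSize≡1 : ∀ j → fibreSize j ≡ 1
    fibreSize≡1 j = let (x , x∈S , cx≡j) = surj j in
      ≤-antisym (fibreSize≤1 inj j) (1≤count (fibre? j) (x∈S , cx≡j))
    count-all : ∀ k → ∑[ j < k ] 1 ≡ k
    count-all zero    = refl
    count-all (suc k) = cong suc (count-all k)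

∑-select : ∀ {n} (f : Fin n → ℕ) (a : Fin n) → ∑[ w < n ] (f w * ⟦ a ≟ w ⟧) ≡ f a
∑-select {suc n} f zero = begin
  f zero * 1 + ∑[ w < n ] (f (suc w) * 0) ≡⟨ cong₂ _+_ (*-identityʳ (f zero)) (trans (sum-cong-≗ (λ w → *-zeroʳ (f (suc w)))) (sum-replicate-zero n)) ⟩
  f zero + 0                             ≡⟨ +-identityʳ _ ⟩
  f zero                                 ∎
  where open ≡-Reasoning
∑-select {suc n} f (suc a) = trans (cong (_+ ∑[ w < n ] (f (suc w) * ⟦ a ≟ w ⟧)) (*-zeroʳ (f zero))) (∑-select (f ∘ suc) a)

∑∑-reindex : ∀ {k n} (g : Fin k → Fin n → Fin n) (f : Fin k → Fin n → Fin n → ℕ) →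
  ∑[ i < k ] ∑[ c < n ] f i c (g i c) ≡ ∑[ c < n ] ∑[ w < n ] ∑[ i < k ] (f i c w * ⟦ g i c ≟ w ⟧)
∑∑-reindex {k} {n} g f = begin
  ∑[ i < k ] ∑[ c < n ] f i c (g i c)                          ≡⟨ sum-cong-≗ (λ i → sum-cong-≗ λ c → sym (∑-select (f i c) (g i c))) ⟩
  ∑[ i < k ] ∑[ c < n ] ∑[ w < n ] (f i c w * ⟦ g i c ≟ w ⟧)  ≡⟨ ∑-comm (λ i c → ∑[ w < n ] (f i c w * ⟦ g i c ≟ w ⟧)) ⟩
  ∑[ c < n ] ∑[ i < k ] ∑[ w < n ] (f i c w * ⟦ g i c ≟ w ⟧)  ≡⟨ sum-cong-≗ (λ c → ∑-comm (λ i w → f i c w * ⟦ g i c ≟ w ⟧)) ⟩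
  ∑[ c < n ] ∑[ w < n ] ∑[ i < k ] (f i c w * ⟦ g i c ≟ w ⟧)  ∎
  where open ≡-Reasoning

∑∑-product : ∀ {m n} (x : Fin m → ℕ) (y : Fin n → ℕ) → ∑[ c < m ] ∑[ w < n ] (x c * y w) ≡ sum x * sum y
∑∑-product x y = trans (sum-cong-≗ λ c → sym (*-distribˡ-sum (x c) y)) (sym (*-distribʳ-sum (sum y) x))

∑-scaled-count : ∀ {k} {A B : Pred (Fin k) 0ℓ} (A? : Decidable A) (B? : Decidable B) (s : ℕ) →
  ∑[ i < k ] ((⟦ A? i ⟧ * s) * ⟦ B? i ⟧) ≡ s * count (λ i → A? i ×-dec B? i)
∑-scaled-count A? B? s = trans (sum-cong-≗ λ i → trans (swap ⟦ A? i ⟧ s ⟦ B? i ⟧) (cong (s *_) (sym (⟦×-dec⟧ (A? i) (B? i)))))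
  (sym (*-distribˡ-sum s λ i → ⟦ A? i ×-dec B? i ⟧))
  where
  swap : ∀ a s b → (a * s) * b ≡ s * (a * b)
  swap = solve-∀

subset : ∀ {n} {P : Pred (Fin n) 0ℓ} → Decidable P → Subset n
subset P? = tabulate (does ∘ P?)

module _ {n} {P : Pred (Fin n) 0ℓ} (P? : Decidable P) where

  ∈-subset⁺ : ∀ {x} → P x → x ∈ subset P?
  ∈-subset⁺ {x} p = lookup⇒[]= x (subset P?) (trans (lookup∘tabulate _ x) (dec-true (P? x) p))

  ∈-subset⁻ : ∀ {x} → x ∈ subset P? → P x
  ∈-subset⁻ {x} x∈ with P? x | trans (sym (lookup∘tabulate (does ∘ P?) x)) ([]=⇒lookup x∈)
  ... | yes p | _ = p

funToFin-cong : ∀ {m k} {f g : Fin m → Fin k} → (∀ x → f x ≡ g x) → funToFin f ≡ funToFin g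
funToFin-cong {zero}  f≗g = refl
funToFin-cong {suc m} f≗g = cong₂ combine (f≗g zero) (funToFin-cong (f≗g ∘ suc))

module MapCodes (n : ℕ) where

  decode : Fin (n ^ n) → Fin n → Fin n
  decode = finToFun

  encode : (Fin n → Fin n) → Fin (n ^ n)
  encode = funToFin

  decode-encode : ∀ f x → decode (encode f) x ≡ f x
  decode-encode = finToFun-funToFin

  encode-decode : ∀ i → encode (decode i) ≡ i
  encode-decode = funToFin-finToFin {n} {n}

  private
    conj : Permutation′ n → Permutation′ n → Fin (n ^ n) → Fin (n ^ n)
    conj σ τ i = encode (λ x → τ ⟨$⟩ʳ decode i (σ ⟨$⟩ʳ x))

    conj-flip-conj : ∀ σ τ i → conj (flip σ) (flip τ) (conj σ τ i) ≡ i
    conj-flip-conj σ τ i = trans (funToFin-cong pointwise) (encode-decode i)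
      where
      pointwise : ∀ x → τ ⟨$⟩ˡ decode (conj σ τ i) (σ ⟨$⟩ˡ x) ≡ decode i x
      pointwise x = begin
        τ ⟨$⟩ˡ decode (conj σ τ i) (σ ⟨$⟩ˡ x)            ≡⟨ cong (τ ⟨$⟩ˡ_) (decode-encode _ (σ ⟨$⟩ˡ x)) ⟩
        τ ⟨$⟩ˡ (τ ⟨$⟩ʳ decode i (σ ⟨$⟩ʳ (σ ⟨$⟩ˡ x)))     ≡⟨ inverseˡ τ ⟩
        decode i (σ ⟨$⟩ʳ (σ ⟨$⟩ˡ x))                     ≡⟨ cong (decode i) (inverseʳ σ) ⟩
        decode i x                                       ∎
        where open ≡-Reasoning

  conjugate : Permutation′ n → Permutation′ n → Permutation′ (n ^ n)
  conjugate σ τ = permutation (conj σ τ) (conj (flip σ) (flip τ))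
    (conj-flip-conj (flip σ) (flip τ)) (conj-flip-conj σ τ)

  decode-conjugate : ∀ σ τ i x → decode (conjugate σ τ ⟨$⟩ʳ i) x ≡ τ ⟨$⟩ʳ decode i (σ ⟨$⟩ʳ x)
  decode-conjugate σ τ i = decode-encode _

module _ {n : ℕ} (G : Graph n) where

  record IsAutomorphismMap (f : Fin n → Fin n) : Set where
    constructor isAutomorphismMap
    field
      preserves-adj : ∀ u v → adj G (f u) (f v) ≡ adj G u v
      injective     : ∀ u v → f u ≡ f v → u ≡ v
      surjective    : ∀ v → ∃[ u ] f u ≡ v

  isAutomorphismMap? : ∀ f → Dec (IsAutomorphismMap f)
  isAutomorphismMap? f = map′ (λ (pres , inj , surj) → isAutomorphismMap pres inj surj)
    (λ (isAutomorphismMap pres inj surj) → pres , inj , surj)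
    (all? (λ u → all? λ v → adj G (f u) (f v) Bool.≟ adj G u v) ×-dec
     all? (λ u → all? λ v → f u ≟ f v →-dec u ≟ v) ×-dec
     all? (λ v → any? λ u → f u ≟ v))

  id-automorphismMap : IsAutomorphismMap id
  id-automorphismMap = isAutomorphismMap (λ _ _ → refl) (λ _ _ e → e) (λ v → v , refl)

  automorphismMap-cong : ∀ {f g} → (∀ x → f x ≡ g x) → IsAutomorphismMap f → IsAutomorphismMap g
  automorphismMap-cong f≗g (isAutomorphismMap pres inj surj) = isAutomorphismMap
    (λ u v → trans (sym (cong₂ (adj G) (f≗g u) (f≗g v))) (pres u v))
    (λ u v e → inj u v (trans (f≗g u) (trans e (sym (f≗g v)))))
    (λ v → let (u , fu≡v) = surj v in u , trans (sym (f≗g u)) fu≡v)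

  automorphismMap-∘ : ∀ {f g} → IsAutomorphismMap f → IsAutomorphismMap g → IsAutomorphismMap (g ∘ f)
  automorphismMap-∘ {f} {g} (isAutomorphismMap pres inj surj) (isAutomorphismMap pres′ inj′ surj′) = isAutomorphismMap
    (λ u v → trans (pres′ (f u) (f v)) (pres u v))
    (λ u v e → inj u v (inj′ (f u) (f v) e))
    (λ w → let (v , gv≡w) = surj′ w ; (u , fu≡v) = surj v in u , trans (cong g fu≡v) gv≡w)

  automorphism⇒automorphismMap : ∀ σ → IsAutomorphism G σ → IsAutomorphismMap (σ ⟨$⟩ʳ_)
  automorphism⇒automorphismMap σ aut = isAutomorphismMap aut
    (λ u v e → trans (sym (inverseˡ σ)) (trans (cong (σ ⟨$⟩ˡ_) e) (inverseˡ σ)))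
    (λ v → σ ⟨$⟩ˡ v , inverseʳ σ)

  flip-automorphism : ∀ σ → IsAutomorphism G σ → IsAutomorphism G (flip σ)
  flip-automorphism σ aut u v =
    trans (sym (aut (σ ⟨$⟩ˡ u) (σ ⟨$⟩ˡ v))) (cong₂ (adj G) (inverseʳ σ) (inverseʳ σ))

module _ {n : ℕ} (G : Graph n) where

  complement-edge⁻ : ∀ {u v} → adj (complement G) u v ≡ true → u ≢ v × adj G u v ≡ false
  complement-edge⁻ {u} {v} e with u ≟ v | adj G u v
  ... | yes _   | _     = contradiction e λ ()
  ... | no u≢v  | false = u≢v , refl
  ... | no _    | true  = contradiction e λ ()

  complement-edge⁺ : ∀ {u v} → u ≢ v → adj G u v ≡ false → adj (complement G) u v ≡ true
  complement-edge⁺ {u} {v} u≢v e with u ≟ v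
  ... | yes u≡v = contradiction u≡v u≢v
  ... | no _    rewrite e = refl

  independent⇒complement-clique : ∀ {S} → IsIndependent G S → IsClique (complement G) S
  independent⇒complement-clique indS u v u∈S v∈S u≢v = complement-edge⁺ u≢v (indS u v u∈S v∈S u≢v)

  complement-clique⇒independent : ∀ {S} → IsClique (complement G) S → IsIndependent G S
  complement-clique⇒independent cliqueS u v u∈S v∈S u≢v = proj₂ (complement-edge⁻ (cliqueS u v u∈S v∈S u≢v))

  clique∩independent-unique : ∀ {C I x y} → IsClique G C → IsIndependent G I →
    x ∈ C → y ∈ C → x ∈ I → y ∈ I → x ≡ y
  clique∩independent-unique {x = x} {y} cliqueC indI x∈C y∈C x∈I y∈I with x ≟ y
  ... | yes x≡y = x≡y
  ... | no  x≢y = contradiction (trans (sym (cliqueC x y x∈C y∈C x≢y)) (indI x y x∈I y∈I x≢y)) λ ()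

  Addable : Subset n → Fin n → Set
  Addable S x = x ∉ S × (∀ y → y ∈ S → adj G x y ≡ false)

  addable? : ∀ S x → Dec (Addable S x)
  addable? S x = ¬? (x ∈? S) ×-dec all? (λ y → y ∈? S →-dec adj G x y Bool.≟ false)

  addable-independent : ∀ {S x} → IsIndependent G S → Addable S x → IsIndependent G (S ∪ ⁅ x ⁆)
  addable-independent {S} {x} indS (_ , x≁S) u v u∈ v∈ u≢v
    with x∈p∪q⁻ S ⁅ x ⁆ u∈ | x∈p∪q⁻ S ⁅ x ⁆ v∈
  ... | inj₁ u∈S | inj₁ v∈S = indS u v u∈S v∈S u≢v
  ... | inj₁ u∈S | inj₂ v∈x rewrite x∈⁅y⁆⇒x≡y x v∈x = trans (adj-sym G u x) (x≁S u u∈S)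
  ... | inj₂ u∈x | inj₁ v∈S rewrite x∈⁅y⁆⇒x≡y x u∈x = x≁S v v∈S
  ... | inj₂ u∈x | inj₂ v∈x = contradiction (trans (x∈⁅y⁆⇒x≡y x u∈x) (sym (x∈⁅y⁆⇒x≡y x v∈x))) u≢v

  nothing-addable⇒maximal : ∀ {S} → IsIndependent G S → (∀ x → ¬ Addable S x) → IsMaximalIndependent G S
  nothing-addable⇒maximal {S} indS none = indS , maximal
    where
    maximal : ∀ T → IsIndependent G T → S ⊆ T → T ⊆ S
    maximal T indT S⊆T {t} t∈T with t ∈? S
    ... | yes t∈S = t∈S
    ... | no  t∉S = contradiction (t∉S , λ y y∈S → indT t y t∈T (S⊆T y∈S) λ { refl → t∉S y∈S }) (none t)

  maximalIndependent-extension : ∀ S → IsIndependent G S → ∃[ J ] (IsMaximalIndependent G J × S ⊆ J)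
  maximalIndependent-extension S = go S (⊃-wellFounded S)
    where
    go : ∀ S → Acc _⊃_ S → IsIndependent G S → ∃[ J ] (IsMaximalIndependent G J × S ⊆ J)
    go S (acc larger) indS with any? (addable? S)
    ... | no none = S , nothing-addable⇒maximal indS (λ x a → none (x , a)) , λ x∈S → x∈S
    ... | yes (x , x-addable@(x∉S , _)) =
      let (J , maxJ , S∪x⊆J) = go (S ∪ ⁅ x ⁆) (larger ((λ {y} → p⊆p∪q ⁅ x ⁆) , x , q⊆p∪q S ⁅ x ⁆ (x∈⁅x⁆ x) , x∉S))
                                   (addable-independent indS x-addable)
      in J , maxJ , λ y∈S → S∪x⊆J (p⊆p∪q ⁅ x ⁆ y∈S)

  properColouring-injectiveOn-clique : ∀ {k S} (c : Fin n → Fin k) → (∀ u v → adj G u v ≡ true → c u ≢ c v) →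
    IsClique G S → InjectiveOn S c
  properColouring-injectiveOn-clique c proper cliqueS {x} {y} x∈S y∈S cx≡cy with x ≟ y
  ... | yes x≡y = x≡y
  ... | no  x≢y = contradiction cx≡cy (proper x y (cliqueS x y x∈S y∈S x≢y))

  colouring∧clique⇒χ≡ω : ∀ {k S} → Colourable G k → IsClique G S → ∣ S ∣ ≡ k → ChiEqualsOmega G
  colouring∧clique⇒χ≡ω {k} {S} colouring@(c , proper) cliqueS ∣S∣≡k =
    k , (colouring , least) , (S , cliqueS , ∣S∣≡k) , largest
    where
    least : ∀ k′ → Colourable G k′ → k ≤ k′
    least k′ (c′ , proper′) =
      ≤-trans (≤-reflexive (sym ∣S∣≡k)) (injectiveOn⇒∣∣≤ S c′ (properColouring-injectiveOn-clique c′ proper′ cliqueS))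
    largest : ∀ S′ → IsClique G S′ → ∣ S′ ∣ ≤ k
    largest S′ cliqueS′ = injectiveOn⇒∣∣≤ S′ c (properColouring-injectiveOn-clique c proper cliqueS′)

  ⊥-independent : IsIndependent G ⊥
  ⊥-independent u v u∈⊥ = contradiction u∈⊥ ∉⊥

module _ {n : ℕ} (G : Graph n) where

  automorphismMap-inverse : ∀ {f} → IsAutomorphismMap G f →
    ∃[ g ] (IsAutomorphismMap G g × (∀ x → g (f x) ≡ x) × (∀ y → f (g y) ≡ y))
  automorphismMap-inverse {f} (isAutomorphismMap pres inj surj) = g , isAutomorphismMap pres′ inj′ surj′ , gf , fg
    where
    g : Fin n → Fin n
    g y = proj₁ (surj y)
    fg : ∀ y → f (g y) ≡ y
    fg y = proj₂ (surj y)
    gf : ∀ x → g (f x) ≡ x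
    gf x = inj _ _ (fg (f x))
    pres′ : ∀ u v → adj G (g u) (g v) ≡ adj G u v
    pres′ u v = trans (sym (pres (g u) (g v))) (cong₂ (adj G) (fg u) (fg v))
    inj′ : ∀ u v → g u ≡ g v → u ≡ v
    inj′ u v e = trans (sym (fg u)) (trans (cong f e) (fg v))
    surj′ : ∀ x → ∃[ y ] g y ≡ x
    surj′ x = f x , gf x

  preimage : (Fin n → Fin n) → Subset n → Subset n
  preimage f I = subset (λ x → f x ∈? I)

  ∈-preimage⁺ : ∀ f {I x} → f x ∈ I → x ∈ preimage f I
  ∈-preimage⁺ f {I} = ∈-subset⁺ (λ x → f x ∈? I)

  ∈-preimage⁻ : ∀ f {I x} → x ∈ preimage f I → f x ∈ I
  ∈-preimage⁻ f {I} = ∈-subset⁻ (λ x → f x ∈? I)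

  preimage-independent : ∀ {f I} → IsAutomorphismMap G f → IsIndependent G I → IsIndependent G (preimage f I)
  preimage-independent {f} (isAutomorphismMap pres inj _) indI u v u∈ v∈ u≢v =
    trans (sym (pres u v)) (indI (f u) (f v) (∈-preimage⁻ f u∈) (∈-preimage⁻ f v∈) (u≢v ∘ inj u v))

  preimage-maximalIndependent : ∀ {f I} → IsAutomorphismMap G f → IsMaximalIndependent G I →
    IsMaximalIndependent G (preimage f I)
  preimage-maximalIndependent {f} {I} autf (indI , maxI)
    with g , autg , gf , fg ← automorphismMap-inverse autf = preimage-independent autf indI , maximal
    where
    maximal : ∀ T → IsIndependent G T → preimage f I ⊆ T → T ⊆ preimage f I
    maximal T indT f⁻¹I⊆T {t} t∈T = ∈-preimage⁺ f (maxI (preimage g T) (preimage-independent autg indT) I⊆g⁻¹T ft∈g⁻¹T)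
      where
      I⊆g⁻¹T : I ⊆ preimage g T
      I⊆g⁻¹T {y} y∈I = ∈-preimage⁺ g (f⁻¹I⊆T (∈-preimage⁺ f (subst (_∈ I) (sym (fg y)) y∈I)))
      ft∈g⁻¹T : f t ∈ preimage g T
      ft∈g⁻¹T = ∈-preimage⁺ g (subst (_∈ T) (sym (gf t)) t∈T)

  strongClique-meets-image-once : ∀ {C f I} → IsStrongClique G C → IsAutomorphismMap G f → IsMaximalIndependent G I →
    count (λ c → c ∈? C ×-dec f c ∈? I) ≡ 1
  strongClique-meets-image-once {C} {f} {I} (cliqueC , meets) autf maxI
    with c , c∈C , c∈f⁻¹I ← meets (preimage f I) (preimage-maximalIndependent autf maxI)
    = count≡1 (λ c → c ∈? C ×-dec f c ∈? I) (c∈C , ∈-preimage⁻ f c∈f⁻¹I) unique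
    where
    unique : AtMostOne (λ x → x ∈ C × f x ∈ I)
    unique (x∈C , fx∈I) (y∈C , fy∈I) = clique∩independent-unique G cliqueC (preimage-independent autf (proj₁ maxI))
      x∈C y∈C (∈-preimage⁺ f fx∈I) (∈-preimage⁺ f fy∈I)

module _ {n : ℕ} (G : Graph n) where

  open MapCodes n

  automorphismMap-conjugate⇔ : ∀ σ τ {f g} → IsAutomorphism G σ → IsAutomorphism G τ →
    (∀ x → g x ≡ τ ⟨$⟩ʳ f (σ ⟨$⟩ʳ x)) → IsAutomorphismMap G g ⇔ IsAutomorphismMap G f
  automorphismMap-conjugate⇔ σ τ {f} {g} autσ autτ g≗τfσ = mk⇔
    (λ autg → automorphismMap-cong G undo
      (automorphismMap-∘ G (automorphism⇒automorphismMap G (flip σ) (flip-automorphism G σ autσ))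
        (automorphismMap-∘ G autg (automorphism⇒automorphismMap G (flip τ) (flip-automorphism G τ autτ)))))
    (λ autf → automorphismMap-cong G (sym ∘ g≗τfσ) (automorphismMap-∘ G (automorphism⇒automorphismMap G σ autσ)
      (automorphismMap-∘ G autf (automorphism⇒automorphismMap G τ autτ))))
    where
    undo : ∀ x → τ ⟨$⟩ˡ g (σ ⟨$⟩ˡ x) ≡ f x
    undo x = trans (cong (τ ⟨$⟩ˡ_) (g≗τfσ (σ ⟨$⟩ˡ x))) (trans (inverseˡ τ) (cong f (inverseʳ σ)))

  isAutomorphismCode? : Decidable (λ i → IsAutomorphismMap G (decode i))
  isAutomorphismCode? i = isAutomorphismMap? G (decode i)

  #Aut : ℕ
  #Aut = count isAutomorphismCode?

  automorphismCode-mapping? : ∀ c w → Decidable (λ i → IsAutomorphismMap G (decode i) × decode i c ≡ w)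
  automorphismCode-mapping? c w i = isAutomorphismCode? i ×-dec decode i c ≟ w

  #Aut[_↦_] : Fin n → Fin n → ℕ
  #Aut[ c ↦ w ] = count (automorphismCode-mapping? c w)

  #Aut[↦]-invariant : VertexTransitive G → ∀ c w c′ w′ → #Aut[ c ↦ w ] ≡ #Aut[ c′ ↦ w′ ]
  #Aut[↦]-invariant vt c w c′ w′ with σ , autσ , σc≡c′ ← vt c c′ | τ , autτ , τw′≡w ← vt w′ w =
    count-permute (automorphismCode-mapping? c w) (automorphismCode-mapping? c′ w′) (conjugate σ τ) λ i →
      mk⇔ (λ (aut , maps) → Equivalence.to (conjugate-aut i) aut , maps⇒ i maps)
          (λ (aut , maps) → Equivalence.from (conjugate-aut i) aut , ⇒maps i maps)
    where
    conjugate-aut : ∀ i → IsAutomorphismMap G (decode (conjugate σ τ ⟨$⟩ʳ i)) ⇔ IsAutomorphismMap G (decode i)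
    conjugate-aut i = automorphismMap-conjugate⇔ σ τ autσ autτ (decode-conjugate σ τ i)
    conjugate-at-c : ∀ i → decode (conjugate σ τ ⟨$⟩ʳ i) c ≡ τ ⟨$⟩ʳ decode i c′
    conjugate-at-c i = trans (decode-conjugate σ τ i c) (cong (λ z → τ ⟨$⟩ʳ decode i z) σc≡c′)
    maps⇒ : ∀ i → decode (conjugate σ τ ⟨$⟩ʳ i) c ≡ w → decode i c′ ≡ w′
    maps⇒ i e = begin
      decode i c′                          ≡⟨ inverseˡ τ ⟨
      τ ⟨$⟩ˡ (τ ⟨$⟩ʳ decode i c′)          ≡⟨ cong (τ ⟨$⟩ˡ_) (trans (sym (conjugate-at-c i)) (trans e (sym τw′≡w))) ⟩
      τ ⟨$⟩ˡ (τ ⟨$⟩ʳ w′)                      ≡⟨ inverseˡ τ ⟩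
      w′                                     ∎
      where open ≡-Reasoning
    ⇒maps : ∀ i → decode i c′ ≡ w′ → decode (conjugate σ τ ⟨$⟩ʳ i) c ≡ w
    ⇒maps i e = trans (conjugate-at-c i) (trans (cong (τ ⟨$⟩ʳ_) e) τw′≡w)

  1≤#Aut[↦] : ∀ c → 1 ≤ #Aut[ c ↦ c ]
  1≤#Aut[↦] c = 1≤count (automorphismCode-mapping? c c) {encode id}
    (automorphismMap-cong G (sym ∘ decode-encode id) (id-automorphismMap G) , decode-encode id c)

  #Aut≡∣C∣*∣I∣*#Aut[↦] : VertexTransitive G → ∀ {C I} → IsStrongClique G C → IsMaximalIndependent G I → ∀ c₀ →
    #Aut ≡ (∣ C ∣ * ∣ I ∣) * #Aut[ c₀ ↦ c₀ ]
  #Aut≡∣C∣*∣I∣*#Aut[↦] vt {C} {I} strongC maxI c₀ = begin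
    ∑[ i < n ^ n ] ⟦ A? i ⟧
      ≡⟨ sum-cong-≗ weight ⟩
    ∑[ i < n ^ n ] ∑[ c < n ] (⟦ A? i ⟧ * (x c * y (decode i c)))
      ≡⟨ ∑∑-reindex decode (λ i c w → ⟦ A? i ⟧ * (x c * y w)) ⟩
    ∑[ c < n ] ∑[ w < n ] ∑[ i < n ^ n ] ((⟦ A? i ⟧ * (x c * y w)) * ⟦ decode i c ≟ w ⟧)
      ≡⟨ sum-cong-≗ (λ c → sum-cong-≗ λ w → ∑-scaled-count A? (λ i → decode i c ≟ w) (x c * y w)) ⟩
    ∑[ c < n ] ∑[ w < n ] ((x c * y w) * #Aut[ c ↦ w ])
      ≡⟨ sum-cong-≗ (λ c → sum-cong-≗ λ w → cong ((x c * y w) *_) (#Aut[↦]-invariant vt c w c₀ c₀)) ⟩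
    ∑[ c < n ] ∑[ w < n ] ((x c * y w) * N₀)
      ≡⟨ sum-cong-≗ (λ c → *-distribʳ-sum N₀ (λ w → x c * y w)) ⟨
    ∑[ c < n ] (∑[ w < n ] (x c * y w) * N₀)
      ≡⟨ *-distribʳ-sum N₀ (λ c → ∑[ w < n ] (x c * y w)) ⟨
    ∑[ c < n ] ∑[ w < n ] (x c * y w) * N₀
      ≡⟨ cong (_* N₀) (trans (∑∑-product x y) (sym (cong₂ _*_ (∣∣≡count C) (∣∣≡count I)))) ⟩
    (∣ C ∣ * ∣ I ∣) * N₀ ∎
    where
    open ≡-Reasoning
    A? = isAutomorphismCode?
    N₀ = #Aut[ c₀ ↦ c₀ ]
    x y : Fin n → ℕ
    x c = ⟦ c ∈? C ⟧
    y w = ⟦ w ∈? I ⟧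
    hits : ∀ i → IsAutomorphismMap G (decode i) → ∑[ c < n ] (x c * y (decode i c)) ≡ 1
    hits i aut = trans (sum-cong-≗ λ c → sym (⟦×-dec⟧ (c ∈? C) (decode i c ∈? I)))
      (strongClique-meets-image-once G strongC aut maxI)
    weight : ∀ i → ⟦ A? i ⟧ ≡ ∑[ c < n ] (⟦ A? i ⟧ * (x c * y (decode i c)))
    weight i = trans (sym (⟦⟧*≡⟦⟧ (A? i) (hits i))) (*-distribˡ-sum ⟦ A? i ⟧ λ c → x c * y (decode i c))

  maximalIndependent-equicardinal : VertexTransitive G → HasStrongClique G → ∀ {I J} →
    IsMaximalIndependent G I → IsMaximalIndependent G J → ∣ I ∣ ≡ ∣ J ∣
  maximalIndependent-equicardinal vt (C , strongC) {I} {J} maxI maxJ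
    with c₀ , c₀∈C , _ ← proj₂ strongC I maxI =
    *-cancelˡ-≡ (∣ I ∣) (∣ J ∣) (∣ C ∣) {{>-nonZero C≠∅}}
      (*-cancelʳ-≡ (∣ C ∣ * ∣ I ∣) (∣ C ∣ * ∣ J ∣) #Aut[ c₀ ↦ c₀ ] {{>-nonZero (1≤#Aut[↦] c₀)}}
        (trans (sym (#Aut≡∣C∣*∣I∣*#Aut[↦] vt strongC maxI c₀)) (#Aut≡∣C∣*∣I∣*#Aut[↦] vt strongC maxJ c₀)))
    where
    C≠∅ : 1 ≤ ∣ C ∣
    C≠∅ = ≤-trans (1≤count (_∈? C) c₀∈C) (≤-reflexive (sym (∣∣≡count C)))

module _ {n : ℕ} (Γ : Graph n) where

  localizable⇒χ≡ω : Localizable Γ → ChiEqualsOmega (complement Γ)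
  localizable⇒χ≡ω (k , P , strong , unique) with M , maxM@(indM , _) , _ ← maximalIndependent-extension Γ ⊥ (⊥-independent Γ) =
    colouring∧clique⇒χ≡ω (complement Γ) (colour , proper) (independent⇒complement-clique Γ indM) ∣M∣≡k
    where
    colour : Fin n → Fin k
    colour v = proj₁ (unique v)
    v∈P[colour] : ∀ v → v ∈ P (colour v)
    v∈P[colour] v = proj₁ (proj₂ (unique v))
    same-colour-adjacent : ∀ {u v} → u ≢ v → colour u ≡ colour v → adj Γ u v ≡ true
    same-colour-adjacent {u} {v} u≢v eq =
      proj₁ (strong (colour u)) u v (v∈P[colour] u) (subst (λ j → v ∈ P j) (sym eq) (v∈P[colour] v)) u≢v
    proper : ∀ u v → adj (complement Γ) u v ≡ true → colour u ≢ colour v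
    proper u v e eq = let (u≢v , nonadj) = complement-edge⁻ Γ e in
      contradiction (trans (sym (same-colour-adjacent u≢v eq)) nonadj) λ ()
    ∣M∣≡k : ∣ M ∣ ≡ k
    ∣M∣≡k = bijectiveOn⇒∣∣≡ M colour injective surjective
      where
      injective : InjectiveOn M colour
      injective {x} {y} x∈M y∈M eq = clique∩independent-unique Γ (proj₁ (strong (colour x))) indM
        (v∈P[colour] x) (subst (λ j → y ∈ P j) (sym eq) (v∈P[colour] y)) x∈M y∈M
      surjective : SurjectiveOn M colour
      surjective j = let (v , v∈Pj , v∈M) = proj₂ (strong j) M maxM in v , v∈M , proj₂ (proj₂ (unique v)) v∈Pj

  χ≡ω⇒localizable : VertexTransitive Γ → HasStrongClique Γ → ChiEqualsOmega (complement Γ) → Localizable Γ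
  χ≡ω⇒localizable vt hasStrong (k , ((colour , proper) , _) , (S , cliqueS , ∣S∣≡k) , largest)
    with J , maxJ , S⊆J ← maximalIndependent-extension Γ S (complement-clique⇒independent Γ cliqueS) =
    k , colourClass , strong , λ v → colour v , ∈-subset⁺ (class? (colour v)) refl , ∈-subset⁻ (class? _)
    where
    class? : ∀ j → Decidable (λ x → colour x ≡ j)
    class? j x = colour x ≟ j
    colourClass : Fin k → Subset n
    colourClass j = subset (class? j)
    ∣J∣≡k : ∣ J ∣ ≡ k
    ∣J∣≡k = ≤-antisym (largest J (independent⇒complement-clique Γ (proj₁ maxJ)))
      (≤-trans (≤-reflexive (sym ∣S∣≡k)) (p⊆q⇒∣p∣≤∣q∣ S⊆J))
    strong : ∀ j → IsStrongClique Γ (colourClass j)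
    strong j = clique , meets
      where
      clique : IsClique Γ (colourClass j)
      clique u v u∈ v∈ u≢v with adj Γ u v in e
      ... | true  = refl
      ... | false = contradiction (trans (∈-subset⁻ (class? j) u∈) (sym (∈-subset⁻ (class? j) v∈)))
                      (proper u v (complement-edge⁺ Γ u≢v e))
      meets : ∀ I → IsMaximalIndependent Γ I → ∃[ v ] (v ∈ colourClass j × v ∈ I)
      meets I maxI =
        let (v , v∈I , colour-v≡j) = injectiveOn∧∣∣≡⇒surjectiveOn I colour
              (properColouring-injectiveOn-clique (complement Γ) colour proper (independent⇒complement-clique Γ (proj₁ maxI)))
              (trans (maximalIndependent-equicardinal Γ vt hasStrong maxI maxJ) ∣J∣≡k) j
        in v , ∈-subset⁺ (class? j) colour-v≡j , v∈I

corollary3p3 : ∀ {n : ℕ} (Γ : Graph n) → VertexTransitive Γ → HasStrongClique Γ →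
    (Localizable Γ ⇔ ChiEqualsOmega (complement Γ))
corollary3p3 Γ vt hs = mk⇔ (localizable⇒χ≡ω Γ) (χ≡ω⇒localizable Γ vt hs)
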